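{- Let $r\geq 3$ and $n\in\mathbb N$ be integers and let $\delta:=1/(600r^{3/2})$. Let $G$ be a graph on $n$ vertices with $\delta(G)\geq(1-\delta)n$, and let $X\subseteq V(G)$ with $|X|\leq\delta rn$. Let $\mathcal A$ be the set of cliques $K$ on $r$ vertices in $G$ with $|V(K)\cap X|\geq r^{1/2}$. Then $|\mathcal A|\leq k_r/r^2$.
   Context: $k_r$ denotes the number of cliques on $r$ vertices in $G$; $\delta(G)$ is the minimum degree. -}

module Defs where

open import Data.Nat using (ℕ; zero; suc; _≤_; _≟_)
open import Data.Bool using (Bool; true; false)
open import Data.Fin using (Fin)
open import Data.Fin.Properties using (all?) renaming (_≟_ to _≟ᶠ_)
open import Data.Fin.Subset using (Subset; _∈_; _∩_; ∣_∣)
open import Data.Fin.Subset.Properties using (_∈?_)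
open import Data.List using (List; []; _∷_; _++_; map; filter; length)
open import Data.Vec using (tabulate) renaming (_∷_ to _∷ᵥ_; [] to []ᵥ)
open import Data.Product using (_×_)
open import Relation.Binary.PropositionalEquality using (_≡_; _≢_)
open import Relation.Nullary using (Dec; ¬_)
open import Relation.Nullary.Decidable using (_→-dec_; _×-dec_; ¬?)
open import Relation.Unary using (Pred; Decidable)

record Graph (n : ℕ) : Set where
  field
    adj    : Fin n → Fin n → Bool
    sym    : ∀ i j → adj i j ≡ adj j i
    irrefl : ∀ i → adj i i ≡ false
open Graph public

N : ∀ {n} → Graph n → Fin n → Subset n
N G v = tabulate (adj G v)

deg : ∀ {n} → Graph n → Fin n → ℕ
deg G v = ∣ N G v ∣

IsClique : ∀ {n} → Graph n → Subset n → Set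
IsClique G S = ∀ i j → i ∈ S → j ∈ S → i ≢ j → adj G i j ≡ true

isClique? : ∀ {n} (G : Graph n) → Decidable (IsClique G)
isClique? G S = all? λ i → all? λ j →
  (i ∈? S) →-dec ((j ∈? S) →-dec ((¬? (i ≟ᶠ j)) →-dec (Data.Bool._≟_ (adj G i j) true)))
  where import Data.Bool

IsRClique : ∀ {n} → Graph n → ℕ → Subset n → Set
IsRClique G r S = IsClique G S × ∣ S ∣ ≡ r

isRClique? : ∀ {n} (G : Graph n) r → Decidable (IsRClique G r)
isRClique? G r S = isClique? G S ×-dec (∣ S ∣ ≟ r)

allSubsets : ∀ n → List (Subset n)
allSubsets zero    = []ᵥ ∷ []
allSubsets (suc n) = map (true ∷ᵥ_) (allSubsets n) ++ map (false ∷ᵥ_) (allSubsets n)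

countSubsets : ∀ {n} {P : Pred (Subset n) Agda.Primitive.lzero} → Decidable P → ℕ
countSubsets {n} P? = length (filter P? (allSubsets n))

k : ∀ {n} → Graph n → ℕ → ℕ
k G r = countSubsets (isRClique? G r)

module Submission where

-- Let a_t be the number of r-cliques K with |K ∩ X| ≥ t. Take such a K with |K ∩ X| ≥ t + 1 and
-- u ∈ K ∩ X. Every vertex has at most n/(2r) non-neighbours, so at least n/2 vertices w ∉ K are
-- adjacent to all of K − u, and exchanging u for w yields an r-clique K′ with |K′ ∩ X| ≥ t,
-- u ∈ X and w ∈ K′. For fixed (u, w) the exchange is the transposition of u and w, hence
-- invertible, and double counting the triples (K, u, w) gives (t + 1) n a_{t+1} ≤ 2 |X| r a_t.
-- Since |X| ≤ n / (600 √r), this says a_{t+1} ≤ a_t / 150 as soon as 2 (t + 1) ≥ √r. Starting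
-- from t = ⌊T/2⌋, where T = ⌈√r⌉, and iterating ⌈T/2⌉ times gives
-- |𝒜| ≤ a_T ≤ k_r / 150^⌈T/2⌉ ≤ k_r / r².

open import Defs hiding (sym)
open import Data.Bool using (true; if_then_else_)
import Data.Bool as Bool
open import Data.Fin using (Fin; zero; suc)
open import Data.Fin.Properties using (_≟_; all?; ¬∀⟶∃¬)
open import Data.Fin.Permutation.Components using (transpose; transpose-inverse)
open import Data.Fin.Subset using (Subset; _∈_; _∉_; _⊆_; _∩_; _∪_; ∁; ⁅_⁆; ∣_∣; inside; outside)
open import Data.Fin.Subset.Properties
  using (_∈?_; ∣p∣≤∣x∷p∣; x∈p∩q⁺; x∈p∩q⁻; x∈p∪q⁺; x∈⁅x⁆; x∉p⇒x∈∁p; p⊆q⇒∣p∣≤∣q∣; ∣⁅x⁆∣≡1; ∣∁p∣≡n∸∣p∣)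
open import Data.List using (List; []; _∷_; map; length; filter; allFin)
open import Data.List.Properties using (map-cong; map-∘; map-tabulate; length-tabulate)
import Data.List.Membership.Propositional as List
open import Data.List.Membership.Propositional.Properties using (∈-map⁺; ∈-map⁻; ∈-++⁺ˡ; ∈-++⁺ʳ; ∈-allFin)
open import Data.List.Membership.Propositional.Properties.WithK using (unique∧set⇒bag)
open import Data.List.Relation.Binary.BagAndSetEquality using (∼bag⇒↭)
open import Data.List.Relation.Binary.Permutation.Propositional.Properties using (map⁺)
open import Data.List.Relation.Unary.All using ([])
open import Data.List.Relation.Unary.AllPairs using ([]; _∷_)
open import Data.List.Relation.Unary.Any using (here; there)
open import Data.List.Relation.Unary.Unique.Propositional using (Unique)
import Data.List.Relation.Unary.Unique.Propositional.Properties as Unique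
open import Data.Nat
  using (ℕ; zero; suc; _+_; _*_; _^_; _∸_; _≤_; _≤′_; _≤?_; z≤n; s≤s; ≤′-refl; ≤′-step; NonZero; >-nonZero; ⌊_/2⌋; ⌈_/2⌉)
open import Data.Nat.ListAction using (sum)
open import Data.Nat.ListAction.Properties using (sum-↭)
open import Data.Nat.Properties hiding (_≟_)
open import Data.Nat.Solver using (module +-*-Solver)
open import Data.Product using (Σ; ∃; _×_; _,_; proj₁; proj₂)
open import Data.Sum using (_⊎_; inj₁; inj₂)
open import Data.Vec using ([]; _∷_; lookup; tabulate)
open import Data.Vec.Properties using (lookup∘tabulate; []=⇒lookup; lookup⇒[]=; tabulate∘lookup; tabulate-cong)
open import Function using (_∘_; id; _⇔_; mk⇔)
open import Relation.Binary.PropositionalEquality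
open import Relation.Nullary using (Dec; yes; no; does; ¬_; contradiction)
open import Relation.Nullary.Decidable using (_×-dec_; _→-dec_; ¬?; dec-true; dec-false)
open import Relation.Unary using (Pred; Decidable)

open +-*-Solver using (solve; _:+_; _:*_; _:^_; _:=_; con)

-- Arithmetic

halving : ∀ {n a d} → n ≤ a + d → 2 * d ≤ n → n ≤ 2 * a
halving {n} {a} {d} n≤a+d 2d≤n = +-cancelʳ-≤ n n (2 * a) (begin
  n + n              ≤⟨ +-mono-≤ n≤a+d n≤a+d ⟩
  (a + d) + (a + d)  ≡⟨ solve 2 (λ a d → (a :+ d) :+ (a :+ d) := con 2 :* a :+ con 2 :* d) refl a d ⟩
  2 * a + 2 * d      ≤⟨ +-monoʳ-≤ (2 * a) 2d≤n ⟩
  2 * a + n          ∎)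
  where open ≤-Reasoning

^2-cancel-≤ : ∀ {m n} → m ^ 2 ≤ n ^ 2 → m ≤ n
^2-cancel-≤ m²≤n² = ≮⇒≥ λ n<m → <⇒≱ (^-monoˡ-< 2 n<m) m²≤n²

n≤n^2 : ∀ n → n ≤ n ^ 2
n≤n^2 zero    = z≤n
n≤n^2 (suc n) = m≤m*n (suc n) (suc n * 1)

least : ∀ {P : ℕ → Set} → (∀ m → Dec (P m)) → (∀ {m} → P m → P (suc m)) →
        ∀ b → P b → Σ ℕ λ t → P t × (∀ {m} → P m → t ≤ m)
least P? P-mono zero    P0  = zero , P0 , λ _ → z≤n
least {P} P? P-mono (suc b) P1+b with P? b
... | yes Pb = least P? P-mono b Pb
... | no ¬Pb = suc b , P1+b , λ Pm → ≰⇒> λ m≤b → ¬Pb (upward (≤⇒≤′ m≤b) Pm)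
  where
  upward : ∀ {m k} → m ≤′ k → P m → P k
  upward ≤′-refl        Pm = Pm
  upward (≤′-step m≤′k) Pm = P-mono (upward m≤′k Pm)

least-square-above : ∀ r → Σ ℕ λ t → r ≤ t ^ 2 × (∀ {m} → r ≤ m ^ 2 → t ≤ m)
least-square-above r =
  least (λ m → r ≤? m ^ 2) (λ {m} r≤m² → ≤-trans r≤m² (^-monoˡ-≤ 2 (n≤1+n m))) r (n≤n^2 r)

t≤1+2⌊t/2⌋ : ∀ t → t ≤ 1 + 2 * ⌊ t /2⌋
t≤1+2⌊t/2⌋ zero          = z≤n
t≤1+2⌊t/2⌋ (suc zero)    = s≤s z≤n
t≤1+2⌊t/2⌋ (suc (suc t)) = ≤-trans (s≤s (s≤s (t≤1+2⌊t/2⌋ t)))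
  (≤-reflexive (solve 1 (λ h → con 3 :+ con 2 :* h := con 1 :+ con 2 :* (con 1 :+ h)) refl ⌊ t /2⌋))

odd⁴≤150^ : ∀ j → (1 + 2 * j) ^ 4 ≤ 150 ^ j
odd⁴≤150^ zero    = ≤-refl
odd⁴≤150^ (suc j) = begin
  (1 + 2 * suc j) ^ 4     ≤⟨ ^-monoˡ-≤ 4 (subst (1 + 2 * suc j ≤_) three-times (m≤m+n (1 + 2 * suc j) (4 * j))) ⟩
  (3 * (1 + 2 * j)) ^ 4   ≡⟨ solve 1 (λ j → (con 3 :* (con 1 :+ con 2 :* j)) :^ 4 := con 81 :* (con 1 :+ con 2 :* j) :^ 4) refl j ⟩
  81 * (1 + 2 * j) ^ 4    ≤⟨ *-mono-≤ (m≤m+n 81 69) (odd⁴≤150^ j) ⟩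
  150 * 150 ^ j           ∎
  where
  open ≤-Reasoning
  three-times : 1 + 2 * suc j + 4 * j ≡ 3 * (1 + 2 * j)
  three-times = solve 1 (λ j → con 1 :+ con 2 :* (con 1 :+ j) :+ con 4 :* j := con 3 :* (con 1 :+ con 2 :* j)) refl j

r≤t²⇒r≤[2+2s]² : ∀ {r t s} → r ≤ t ^ 2 → ⌊ t /2⌋ ≤ s → r ≤ (2 * suc s) ^ 2
r≤t²⇒r≤[2+2s]² {t = t} {s} r≤t² ⌊t/2⌋≤s = ≤-trans r≤t² (^-monoˡ-≤ 2 (≤-trans (t≤1+2⌊t/2⌋ t)
  (≤-trans (s≤s (*-monoʳ-≤ 2 ⌊t/2⌋≤s)) (≤-trans (n≤1+n _) (≤-reflexive (sym (*-suc 2 s)))))))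

r≤t²⇒r²≤150^⌈t/2⌉ : ∀ {r t} → r ≤ t ^ 2 → r ^ 2 ≤ 150 ^ ⌈ t /2⌉
r≤t²⇒r²≤150^⌈t/2⌉ {r} {t} r≤t² = begin
  r ^ 2                          ≤⟨ ^-monoˡ-≤ 2 (≤-trans r≤t² (^-monoˡ-≤ 2 t≤1+2⌈t/2⌉)) ⟩
  ((1 + 2 * ⌈ t /2⌉) ^ 2) ^ 2    ≡⟨ ^-*-assoc (1 + 2 * ⌈ t /2⌉) 2 2 ⟩
  (1 + 2 * ⌈ t /2⌉) ^ 4          ≤⟨ odd⁴≤150^ ⌈ t /2⌉ ⟩
  150 ^ ⌈ t /2⌉                  ∎
  where
  open ≤-Reasoning
  t≤1+2⌈t/2⌉ : t ≤ 1 + 2 * ⌈ t /2⌉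
  t≤1+2⌈t/2⌉ = ≤-trans (t≤1+2⌊t/2⌋ t) (+-monoʳ-≤ 1 (*-monoʳ-≤ 2 (⌊n/2⌋≤⌈n/2⌉ t)))

iterate-decay : ∀ {c t} (f : ℕ → ℕ) → (∀ {s} → t ≤ s → c * f (suc s) ≤ f s) →
                ∀ j → c ^ j * f (j + t) ≤ f t
iterate-decay {t = t} f decay zero    = ≤-reflexive (+-identityʳ (f t))
iterate-decay {c} {t} f decay (suc j) = begin
  c * c ^ j * f (suc (j + t))    ≡⟨ trans (cong (_* f (suc (j + t))) (*-comm c (c ^ j))) (*-assoc (c ^ j) c _) ⟩
  c ^ j * (c * f (suc (j + t)))  ≤⟨ *-monoʳ-≤ (c ^ j) (decay (m≤n+m t j)) ⟩
  c ^ j * f (j + t)              ≤⟨ iterate-decay f decay j ⟩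
  f t                            ∎
  where open ≤-Reasoning

[2cm]²r³≤n²⇒2rm≤n : ∀ c {m n r} .{{_ : NonZero c}} → 1 ≤ r → (2 * c * m) ^ 2 * r ^ 3 ≤ n ^ 2 → 2 * r * m ≤ n
[2cm]²r³≤n²⇒2rm≤n c {m} {n} {r} 1≤r hyp = ^2-cancel-≤ (begin
  (2 * r * m) ^ 2                ≡⟨ *-identityʳ _ ⟨
  (2 * r * m) ^ 2 * 1            ≤⟨ *-monoʳ-≤ ((2 * r * m) ^ 2) (*-mono-≤ (m^n>0 c 2) 1≤r) ⟩
  (2 * r * m) ^ 2 * (c ^ 2 * r)  ≡⟨ solve 3 (λ c m r → (con 2 :* r :* m) :^ 2 :* (c :^ 2 :* r) := (con 2 :* c :* m) :^ 2 :* r :^ 3) refl c m r ⟩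
  (2 * c * m) ^ 2 * r ^ 3        ≤⟨ hyp ⟩
  n ^ 2                          ∎)
  where open ≤-Reasoning

decay-step : ∀ c {t n x r a a′} .{{_ : NonZero t}} .{{_ : NonZero n}} →
             r ≤ (2 * t) ^ 2 → (4 * c * x) ^ 2 * r ≤ n ^ 2 →
             a′ * (t * n) ≤ 2 * (a * (x * r)) → c * a′ ≤ a
decay-step c {t} {n} {x} {r} {a} {a′} r≤[2t]² x-small counting =
  ^2-cancel-≤ (*-cancelʳ-≤ _ _ ((4 * (t * n)) ^ 2) {{m^n≢0 (4 * (t * n)) 2 {{m*n≢0 4 (t * n) {{_}} {{m*n≢0 t n}}}}}} (begin
    (c * a′) ^ 2 * (4 * (t * n)) ^ 2       ≡⟨ solve 3 (λ c a′ m → (c :* a′) :^ 2 :* (con 4 :* m) :^ 2 := (con 4 :* c) :^ 2 :* (a′ :* m) :^ 2) refl c a′ (t * n) ⟩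
    (4 * c) ^ 2 * (a′ * (t * n)) ^ 2       ≤⟨ *-monoʳ-≤ ((4 * c) ^ 2) (^-monoˡ-≤ 2 counting) ⟩
    (4 * c) ^ 2 * (2 * (a * (x * r))) ^ 2  ≡⟨ solve 4 (λ c a x r → (con 4 :* c) :^ 2 :* (con 2 :* (a :* (x :* r))) :^ 2
                                                                    := con 4 :* a :^ 2 :* r :* ((con 4 :* c :* x) :^ 2 :* r)) refl c a x r ⟩
    4 * a ^ 2 * r * ((4 * c * x) ^ 2 * r)  ≤⟨ *-monoʳ-≤ (4 * a ^ 2 * r) x-small ⟩
    4 * a ^ 2 * r * n ^ 2                  ≤⟨ *-monoˡ-≤ (n ^ 2) (*-monoʳ-≤ (4 * a ^ 2) r≤[2t]²) ⟩
    4 * a ^ 2 * (2 * t) ^ 2 * n ^ 2        ≡⟨ solve 3 (λ a t n → con 4 :* a :^ 2 :* (con 2 :* t) :^ 2 :* n :^ 2 := a :^ 2 :* (con 4 :* (t :* n)) :^ 2) refl a t n ⟩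
    a ^ 2 * (4 * (t * n)) ^ 2              ∎))
  where open ≤-Reasoning

-- Finite sums and indicators

𝟙 : ∀ {P : Set} → Dec P → ℕ
𝟙 P? = if does P? then 1 else 0

module _ {A : Set} where

  ∑ : List A → (A → ℕ) → ℕ
  ∑ xs f = sum (map f xs)

  infix 5 ∑
  syntax ∑ xs (λ x → e) = ∑[ x ∈ xs ] e

  ∑-cong : ∀ xs {f g : A → ℕ} → (∀ x → f x ≡ g x) → ∑ xs f ≡ ∑ xs g
  ∑-cong xs f≗g = cong sum (map-cong f≗g xs)

  ∑-mono-≤ : ∀ xs {f g : A → ℕ} → (∀ x → f x ≤ g x) → ∑ xs f ≤ ∑ xs g
  ∑-mono-≤ []       f≤g = z≤n
  ∑-mono-≤ (x ∷ xs) f≤g = +-mono-≤ (f≤g x) (∑-mono-≤ xs f≤g)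

  ∑-distrib-+ : ∀ xs (f g : A → ℕ) → ∑[ x ∈ xs ] (f x + g x) ≡ ∑ xs f + ∑ xs g
  ∑-distrib-+ []       f g = refl
  ∑-distrib-+ (x ∷ xs) f g = trans (cong (f x + g x +_) (∑-distrib-+ xs f g))
    (solve 4 (λ a b c d → a :+ b :+ (c :+ d) := a :+ c :+ (b :+ d)) refl (f x) (g x) (∑ xs f) (∑ xs g))

  ∑-*ˡ : ∀ xs c (f : A → ℕ) → ∑[ x ∈ xs ] (c * f x) ≡ c * ∑ xs f
  ∑-*ˡ []       c f = sym (*-zeroʳ c)
  ∑-*ˡ (x ∷ xs) c f = trans (cong (c * f x +_) (∑-*ˡ xs c f)) (sym (*-distribˡ-+ c (f x) _))

  ∑-*ʳ : ∀ xs c (f : A → ℕ) → ∑[ x ∈ xs ] (f x * c) ≡ ∑ xs f * c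
  ∑-*ʳ xs c f = trans (∑-cong xs (λ x → *-comm (f x) c)) (trans (∑-*ˡ xs c f) (*-comm c _))

  ∑-zero : ∀ xs → ∑[ x ∈ xs ] 0 ≡ 0
  ∑-zero []       = refl
  ∑-zero (x ∷ xs) = ∑-zero xs

  ∑-one : ∀ xs → ∑[ x ∈ xs ] 1 ≡ length xs
  ∑-one []       = refl
  ∑-one (x ∷ xs) = cong suc (∑-one xs)

  term≤∑ : ∀ {xs} (f : A → ℕ) {x} → x List.∈ xs → f x ≤ ∑ xs f
  term≤∑ f (here refl)   = m≤m+n (f _) _
  term≤∑ f (there x∈xs) = ≤-trans (term≤∑ f x∈xs) (m≤n+m _ _)

  length-filter≡∑ : ∀ {P : Pred A _} (P? : Decidable P) xs → length (filter P? xs) ≡ ∑[ x ∈ xs ] 𝟙 (P? x)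
  length-filter≡∑ P? []       = refl
  length-filter≡∑ P? (x ∷ xs) with P? x
  ... | yes _ = cong suc (length-filter≡∑ P? xs)
  ... | no  _ = length-filter≡∑ P? xs

  ∑-reindex : ∀ {xs} → Unique xs → (∀ x → x List.∈ xs) →
              (σ σ⁻¹ : A → A) → (∀ x → σ (σ⁻¹ x) ≡ x) → (∀ x → σ⁻¹ (σ x) ≡ x) →
              (f : A → ℕ) → ∑[ x ∈ xs ] f (σ x) ≡ ∑ xs f
  ∑-reindex {xs} unique complete σ σ⁻¹ σσ⁻¹ σ⁻¹σ f =
    trans (cong sum (map-∘ xs)) (sum-↭ (map⁺ f (∼bag⇒↭ (unique∧set⇒bag (Unique.map⁺ σ-injective unique) unique σxs∼xs))))
    where
    σ-injective : ∀ {x y} → σ x ≡ σ y → x ≡ y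
    σ-injective {x} {y} σx≡σy = trans (sym (σ⁻¹σ x)) (trans (cong σ⁻¹ σx≡σy) (σ⁻¹σ y))
    σxs∼xs : ∀ {x} → x List.∈ map σ xs ⇔ x List.∈ xs
    σxs∼xs {x} = mk⇔ (λ _ → complete x) (λ _ → subst (List._∈ map σ xs) (σσ⁻¹ x) (∈-map⁺ σ (complete (σ⁻¹ x))))

module _ {A B : Set} where

  ∑-comm : ∀ (xs : List A) (ys : List B) (f : A → B → ℕ) →
           ∑[ x ∈ xs ] ∑[ y ∈ ys ] f x y ≡ ∑[ y ∈ ys ] ∑[ x ∈ xs ] f x y
  ∑-comm []       ys f = sym (∑-zero ys)
  ∑-comm (x ∷ xs) ys f = trans (cong (∑ ys (f x) +_) (∑-comm xs ys f)) (sym (∑-distrib-+ ys (f x) _))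

  ∑∑-* : ∀ (xs : List A) (ys : List B) (f : A → ℕ) (g : B → ℕ) →
         ∑[ x ∈ xs ] ∑[ y ∈ ys ] f x * g y ≡ ∑ xs f * ∑ ys g
  ∑∑-* xs ys f g = trans (∑-cong xs λ x → ∑-*ˡ ys (f x) g) (∑-*ʳ xs (∑ ys g) f)

∑∑∑-comm : ∀ {A B C : Set} (xs : List A) (ys : List B) (zs : List C) (f : A → B → C → ℕ) →
           ∑[ x ∈ xs ] ∑[ y ∈ ys ] ∑[ z ∈ zs ] f x y z ≡ ∑[ y ∈ ys ] ∑[ z ∈ zs ] ∑[ x ∈ xs ] f x y z
∑∑∑-comm xs ys zs f = trans (∑-comm xs ys _) (∑-cong ys (λ y → ∑-comm xs zs (λ x → f x y)))

∑-allFin-suc : ∀ n (f : Fin (suc n) → ℕ) → ∑ (allFin (suc n)) f ≡ f zero + ∑ (allFin n) (f ∘ suc)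
∑-allFin-suc n f = cong (λ ys → f zero + sum ys) (trans (map-tabulate suc f) (sym (map-tabulate id (f ∘ suc))))

𝟙-yes : ∀ {P : Set} (P? : Dec P) → P → 𝟙 P? ≡ 1
𝟙-yes (yes _) _ = refl
𝟙-yes (no ¬p) p = contradiction p ¬p

𝟙-× : ∀ {P Q : Set} (P? : Dec P) (Q? : Dec Q) → 𝟙 (P? ×-dec Q?) ≡ 𝟙 P? * 𝟙 Q?
𝟙-× (yes _) (yes _) = refl
𝟙-× (yes _) (no  _) = refl
𝟙-× (no  _) _       = refl

𝟙-mono : ∀ {P Q : Set} (P? : Dec P) (Q? : Dec Q) → (P → Q) → 𝟙 P? ≤ 𝟙 Q?
𝟙-mono (yes p) (yes _) P→Q = ≤-refl
𝟙-mono (yes p) (no ¬q) P→Q = contradiction (P→Q p) ¬q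
𝟙-mono (no  _) Q?      P→Q = z≤n

𝟙-cong : ∀ {P Q : Set} (P? : Dec P) (Q? : Dec Q) → (P → Q) → (Q → P) → 𝟙 P? ≡ 𝟙 Q?
𝟙-cong P? Q? P→Q Q→P = ≤-antisym (𝟙-mono P? Q? P→Q) (𝟙-mono Q? P? Q→P)

𝟙*-mono : ∀ {P : Set} (P? : Dec P) {m m′} → (P → m ≤ m′) → 𝟙 P? * m ≤ 𝟙 P? * m′
𝟙*-mono (yes p) P→m≤m′ = +-monoˡ-≤ 0 (P→m≤m′ p)
𝟙*-mono (no  _) P→m≤m′ = z≤n

1≤𝟙+ : ∀ {P : Set} (P? : Dec P) {m} → (¬ P → 1 ≤ m) → 1 ≤ 𝟙 P? + m
1≤𝟙+ (yes _) _       = s≤s z≤n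
1≤𝟙+ (no ¬p) ¬P→1≤m = ¬P→1≤m ¬p

-- Subsets of Fin n

allSubsets-complete : ∀ n (p : Subset n) → p List.∈ allSubsets n
allSubsets-complete zero    []            = here refl
allSubsets-complete (suc n) (inside ∷ p)  = ∈-++⁺ˡ (∈-map⁺ (inside ∷_) (allSubsets-complete n p))
allSubsets-complete (suc n) (outside ∷ p) = ∈-++⁺ʳ _ (∈-map⁺ (outside ∷_) (allSubsets-complete n p))

allSubsets-unique : ∀ n → Unique (allSubsets n)
allSubsets-unique zero    = [] ∷ []
allSubsets-unique (suc n) = Unique.++⁺ (Unique.map⁺ ∷-injectiveʳ (allSubsets-unique n))
                                       (Unique.map⁺ ∷-injectiveʳ (allSubsets-unique n)) disjoint
  where
  ∷-injectiveʳ : ∀ {b} {p q : Subset n} → b ∷ p ≡ b ∷ q → p ≡ q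
  ∷-injectiveʳ refl = refl
  disjoint : ∀ {p} → ¬ (p List.∈ map (inside ∷_) (allSubsets n) × p List.∈ map (outside ∷_) (allSubsets n))
  disjoint (p∈ins , p∈outs) with ∈-map⁻ (inside ∷_) p∈ins | ∈-map⁻ (outside ∷_) p∈outs
  ... | _ , _ , refl | _ , _ , ()

countSubsets≡∑ : ∀ {n} {P : Pred (Subset n) _} (P? : Decidable P) → countSubsets P? ≡ ∑[ K ∈ allSubsets n ] 𝟙 (P? K)
countSubsets≡∑ {n} P? = length-filter≡∑ P? (allSubsets n)

∣p∣≡∑ : ∀ {n} (p : Subset n) → ∣ p ∣ ≡ ∑[ i ∈ allFin n ] 𝟙 (i ∈? p)
∣p∣≡∑         []            = refl
∣p∣≡∑ {suc n} (inside ∷ p)  = trans (cong suc (∣p∣≡∑ p)) (sym (∑-allFin-suc n (λ i → 𝟙 (i ∈? inside ∷ p))))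
∣p∣≡∑ {suc n} (outside ∷ p) = trans (∣p∣≡∑ p) (sym (∑-allFin-suc n (λ i → 𝟙 (i ∈? outside ∷ p))))

∣p∪q∣≤∣p∣+∣q∣ : ∀ {n} (p q : Subset n) → ∣ p ∪ q ∣ ≤ ∣ p ∣ + ∣ q ∣
∣p∪q∣≤∣p∣+∣q∣ []            []            = z≤n
∣p∪q∣≤∣p∣+∣q∣ (inside ∷ p)  (y ∷ q)       = s≤s (≤-trans (∣p∪q∣≤∣p∣+∣q∣ p q) (+-monoʳ-≤ ∣ p ∣ (∣p∣≤∣x∷p∣ y q)))
∣p∪q∣≤∣p∣+∣q∣ (outside ∷ p) (outside ∷ q) = ∣p∪q∣≤∣p∣+∣q∣ p q
∣p∪q∣≤∣p∣+∣q∣ (outside ∷ p) (inside ∷ q)  = ≤-trans (s≤s (∣p∪q∣≤∣p∣+∣q∣ p q)) (≤-reflexive (sym (+-suc _ _)))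

transpose-matchˡ : ∀ {n} (i j : Fin n) → transpose i j i ≡ j
transpose-matchˡ i j rewrite dec-true (i ≟ i) refl = refl

transpose-matchʳ : ∀ {n} (i j : Fin n) → transpose i j j ≡ i
transpose-matchʳ i j with j ≟ i
... | yes j≡i = j≡i
... | no  _   rewrite dec-true (j ≟ j) refl = refl

transpose-other : ∀ {n} {i j k : Fin n} → k ≢ i → k ≢ j → transpose i j k ≡ k
transpose-other {i = i} {j} {k} k≢i k≢j rewrite dec-false (k ≟ i) k≢i | dec-false (k ≟ j) k≢j = refl

permute : ∀ {n} → (Fin n → Fin n) → Subset n → Subset n
permute π p = tabulate (lookup p ∘ π)

module _ {n} {π : Fin n → Fin n} {p : Subset n} {i : Fin n} where

  ∈-permute⁺ : π i ∈ p → i ∈ permute π p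
  ∈-permute⁺ πi∈p = lookup⇒[]= i _ (trans (lookup∘tabulate (lookup p ∘ π) i) ([]=⇒lookup πi∈p))

  ∈-permute⁻ : i ∈ permute π p → π i ∈ p
  ∈-permute⁻ i∈πp = lookup⇒[]= (π i) p (trans (sym (lookup∘tabulate (lookup p ∘ π) i)) ([]=⇒lookup i∈πp))

permute-inverse : ∀ {n} {π ρ : Fin n → Fin n} → (∀ i → π (ρ i) ≡ i) → ∀ p → permute ρ (permute π p) ≡ p
permute-inverse {π = π} {ρ} πρ p =
  trans (tabulate-cong (λ i → trans (lookup∘tabulate (lookup p ∘ π) (ρ i)) (cong (lookup p) (πρ i)))) (tabulate∘lookup p)

∣permute∣ : ∀ {n} {π ρ : Fin n → Fin n} → (∀ i → π (ρ i) ≡ i) → (∀ i → ρ (π i) ≡ i) →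
            ∀ p → ∣ permute π p ∣ ≡ ∣ p ∣
∣permute∣ {n} {π} {ρ} πρ ρπ p = begin
  ∣ permute π p ∣                         ≡⟨ ∣p∣≡∑ (permute π p) ⟩
  ∑[ i ∈ allFin n ] 𝟙 (i ∈? permute π p)  ≡⟨ ∑-cong (allFin n) (λ i → 𝟙-cong (i ∈? permute π p) (π i ∈? p) ∈-permute⁻ ∈-permute⁺) ⟩
  ∑[ i ∈ allFin n ] 𝟙 (π i ∈? p)          ≡⟨ ∑-reindex (Unique.allFin⁺ n) ∈-allFin π ρ πρ ρπ (λ i → 𝟙 (i ∈? p)) ⟩
  ∑[ i ∈ allFin n ] 𝟙 (i ∈? p)            ≡⟨ ∣p∣≡∑ p ⟨
  ∣ p ∣                                   ∎
  where open ≡-Reasoning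

-- Exchanging a vertex of a set

-- For u ∈ K and w ∉ K this is K − u + w; as it comes from a permutation of Fin n, it is a
-- bijection on all subsets, which is what the double counting needs.
swap : ∀ {n} → Fin n → Fin n → Subset n → Subset n
swap u w = permute (transpose u w)

module _ {n} {u w : Fin n} {K : Subset n} where

  ∈-swap⁻ : ∀ {i} → w ∉ K → i ∈ swap u w K → i ≡ w ⊎ (i ∈ K × i ≢ u)
  ∈-swap⁻ {i} w∉K i∈K′ with i ≟ u | i ≟ w
  ... | yes refl | _       = contradiction (subst (_∈ K) (transpose-matchˡ u w) (∈-permute⁻ i∈K′)) w∉K
  ... | no  _    | yes i≡w = inj₁ i≡w
  ... | no  i≢u  | no  i≢w = inj₂ (subst (_∈ K) (transpose-other i≢u i≢w) (∈-permute⁻ i∈K′) , i≢u)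

  ∈-swap⁺ : ∀ {i} → w ∉ K → i ∈ K → i ≢ u → i ∈ swap u w K
  ∈-swap⁺ {i} w∉K i∈K i≢u = ∈-permute⁺ (subst (_∈ K) (sym (transpose-other i≢u i≢w)) i∈K)
    where
    i≢w : i ≢ w
    i≢w refl = w∉K i∈K

  w∈swap : u ∈ K → w ∈ swap u w K
  w∈swap u∈K = ∈-permute⁺ (subst (_∈ K) (sym (transpose-matchʳ u w)) u∈K)

  ∣swap∣ : ∣ swap u w K ∣ ≡ ∣ K ∣
  ∣swap∣ = ∣permute∣ {ρ = transpose w u} (λ _ → transpose-inverse u w) (λ _ → transpose-inverse w u) K

  ∩-swap : ∀ (X : Subset n) → w ∉ K → K ∩ X ⊆ (swap u w K ∩ X) ∪ ⁅ u ⁆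
  ∩-swap X w∉K {i} i∈K∩X with x∈p∩q⁻ K X i∈K∩X | i ≟ u
  ... | _ , _     | yes refl = x∈p∪q⁺ (inj₂ (x∈⁅x⁆ u))
  ... | i∈K , i∈X | no  i≢u  = x∈p∪q⁺ (inj₁ (x∈p∩q⁺ (∈-swap⁺ w∉K i∈K i≢u , i∈X)))

  ∣∩swap∣ : ∀ (X : Subset n) → w ∉ K → ∣ K ∩ X ∣ ≤ suc ∣ swap u w K ∩ X ∣
  ∣∩swap∣ X w∉K = ≤-trans (p⊆q⇒∣p∣≤∣q∣ (∩-swap X w∉K))
    (≤-trans (∣p∪q∣≤∣p∣+∣q∣ (swap u w K ∩ X) ⁅ u ⁆)
      (≤-reflexive (trans (cong (∣ swap u w K ∩ X ∣ +_) (∣⁅x⁆∣≡1 u)) (+-comm _ 1))))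

swap-inverse : ∀ {n} (u w : Fin n) K → swap u w (swap w u K) ≡ K
swap-inverse u w = permute-inverse (λ _ → transpose-inverse w u)

-- Cliques meeting X in many vertices

∈N⁻ : ∀ {n} (G : Graph n) {v w} → w ∈ N G v → adj G v w ≡ true
∈N⁻ G {v} {w} w∈Nv = trans (sym (lookup∘tabulate (adj G v) w)) ([]=⇒lookup w∈Nv)

few-nonNeighbours : ∀ {n r} (G : Graph n) → 1 ≤ r →
                    (∀ v → (600 * (n ∸ deg G v)) ^ 2 * r ^ 3 ≤ n ^ 2) → ∀ v → 2 * r * ∣ ∁ (N G v) ∣ ≤ n
few-nonNeighbours {n} {r} G 1≤r few-nonAdjacent v =
  [2cm]²r³≤n²⇒2rm≤n 300 1≤r (subst (λ m → (600 * m) ^ 2 * r ^ 3 ≤ n ^ 2) (sym (∣∁p∣≡n∸∣p∣ (N G v))) (few-nonAdjacent v))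

module Cliques {n} (G : Graph n) (X : Subset n) (r : ℕ) where

  CliqueAbove : ℕ → Subset n → Set
  CliqueAbove t K = IsRClique G r K × t ≤ ∣ K ∩ X ∣

  cliqueAbove? : ∀ t → Decidable (CliqueAbove t)
  cliqueAbove? t K = isRClique? G r K ×-dec (t ≤? ∣ K ∩ X ∣)

  cliquesAbove : ℕ → ℕ
  cliquesAbove t = countSubsets (cliqueAbove? t)

  cliquesAbove≤k : ∀ t → cliquesAbove t ≤ k G r
  cliquesAbove≤k t = subst₂ _≤_ (sym (countSubsets≡∑ (cliqueAbove? t))) (sym (countSubsets≡∑ (isRClique? G r)))
    (∑-mono-≤ (allSubsets n) λ K → 𝟙-mono (cliqueAbove? t K) (isRClique? G r K) proj₁)

  squares≤cliquesAbove : ∀ {t} → (∀ {m} → r ≤ m ^ 2 → t ≤ m) →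
                         countSubsets (λ K → isRClique? G r K ×-dec (r ≤? ∣ K ∩ X ∣ ^ 2)) ≤ cliquesAbove t
  squares≤cliquesAbove {t} t-least =
    subst₂ _≤_ (sym (countSubsets≡∑ squares?)) (sym (countSubsets≡∑ (cliqueAbove? t)))
      (∑-mono-≤ (allSubsets n) λ K → 𝟙-mono (squares? K) (cliqueAbove? t K) λ (clique , r≤c²) → clique , t-least r≤c²)
    where
    squares? : Decidable (λ K → IsRClique G r K × r ≤ ∣ K ∩ X ∣ ^ 2)
    squares? K = isRClique? G r K ×-dec (r ≤? ∣ K ∩ X ∣ ^ 2)

  CanReplace : Subset n → Fin n → Fin n → Set
  CanReplace K u w = w ∉ K × (∀ v → v ∈ K → v ≢ u → adj G w v ≡ true)

  canReplace? : ∀ K u w → Dec (CanReplace K u w)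
  canReplace? K u w =
    ¬? (w ∈? K) ×-dec all? (λ v → v ∈? K →-dec (¬? (v ≟ u) →-dec (adj G w v Bool.≟ true)))

  swap-clique : ∀ {K u w} → IsClique G K → CanReplace K u w → IsClique G (swap u w K)
  swap-clique clique (w∉K , w~K) i j i∈K′ j∈K′ i≢j with ∈-swap⁻ w∉K i∈K′ | ∈-swap⁻ w∉K j∈K′
  ... | inj₁ refl        | inj₁ refl        = contradiction refl i≢j
  ... | inj₁ refl        | inj₂ (j∈K , j≢u) = w~K j j∈K j≢u
  ... | inj₂ (i∈K , i≢u) | inj₁ refl        = trans (Graph.sym G i j) (w~K i i∈K i≢u)
  ... | inj₂ (i∈K , _)   | inj₂ (j∈K , _)   = clique i j i∈K j∈K i≢j

  -- If w ∈ K, then w itself is the non-neighbour, as G has no loops.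
  ¬CanReplace⇒nonNeighbour : ∀ {K u w} → ¬ CanReplace K u w → ∃ λ v → v ∈ K × w ∈ ∁ (N G v)
  ¬CanReplace⇒nonNeighbour {K} {u} {w} ¬replace with w ∈? K
  ... | yes w∈K = w , w∈K , x∉p⇒x∈∁p λ w∈Nw → contradiction (trans (sym (∈N⁻ G w∈Nw)) (irrefl G w)) λ ()
  ... | no  w∉K with ¬∀⟶∃¬ n _ (λ v → v ∈? K →-dec (¬? (v ≟ u) →-dec (adj G w v Bool.≟ true)))
                          (λ w~K → ¬replace (w∉K , w~K))
  ...   | v , ¬w~v with v ∈? K | v ≟ u | adj G w v Bool.≟ true
  ...     | no  v∉K | _       | _       = contradiction (λ v∈K → contradiction v∈K v∉K) ¬w~v
  ...     | yes _   | yes v≡u | _       = contradiction (λ _ v≢u → contradiction v≡u v≢u) ¬w~v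
  ...     | yes _   | no  _   | yes w~v = contradiction (λ _ _ → w~v) ¬w~v
  ...     | yes v∈K | no  _   | no  w≁v = v , v∈K , x∉p⇒x∈∁p λ w∈Nv → w≁v (trans (Graph.sym G w v) (∈N⁻ G w∈Nv))

  replacements : Subset n → Fin n → ℕ
  replacements K u = ∑[ w ∈ allFin n ] 𝟙 (canReplace? K u w)

  nonAdjacencies : Subset n → ℕ
  nonAdjacencies K = ∑[ v ∈ allFin n ] 𝟙 (v ∈? K) * ∣ ∁ (N G v) ∣

  replacements-cover : ∀ K u → n ≤ replacements K u + nonAdjacencies K
  replacements-cover K u = begin
    n                                                  ≡⟨ trans (sym (length-tabulate id)) (sym (∑-one (allFin n))) ⟩
    ∑[ w ∈ allFin n ] 1                                ≤⟨ ∑-mono-≤ (allFin n) covered ⟩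
    ∑[ w ∈ allFin n ] (𝟙 (canReplace? K u w) + bad w)  ≡⟨ ∑-distrib-+ (allFin n) _ bad ⟩
    replacements K u + ∑ (allFin n) bad                ≡⟨ cong (replacements K u +_) bad-total ⟩
    replacements K u + nonAdjacencies K                ∎
    where
    open ≤-Reasoning
    bad : Fin n → ℕ
    bad w = ∑[ v ∈ allFin n ] 𝟙 (v ∈? K) * 𝟙 (w ∈? ∁ (N G v))
    covered : ∀ w → 1 ≤ 𝟙 (canReplace? K u w) + bad w
    covered w = 1≤𝟙+ (canReplace? K u w) λ ¬replace → nonNeighbour (¬CanReplace⇒nonNeighbour ¬replace)
      where
      nonNeighbour : (∃ λ v → v ∈ K × w ∈ ∁ (N G v)) → 1 ≤ bad w
      nonNeighbour (v , v∈K , w∉Nv) = ≤-trans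
        (≤-reflexive (sym (cong₂ _*_ (𝟙-yes (v ∈? K) v∈K) (𝟙-yes (w ∈? ∁ (N G v)) w∉Nv))))
        (term≤∑ (λ v → 𝟙 (v ∈? K) * 𝟙 (w ∈? ∁ (N G v))) (∈-allFin v))
    bad-total : ∑ (allFin n) bad ≡ nonAdjacencies K
    bad-total = trans (∑-comm (allFin n) (allFin n) _) (∑-cong (allFin n) λ v →
      trans (∑-*ˡ (allFin n) (𝟙 (v ∈? K)) _) (cong (𝟙 (v ∈? K) *_) (sym (∣p∣≡∑ (∁ (N G v))))))

  Switch : ℕ → Subset n → Fin n → Fin n → Set
  Switch s K u w = CliqueAbove (suc s) K × u ∈ K ∩ X × CanReplace K u w

  switch? : ∀ s K u w → Dec (Switch s K u w)
  switch? s K u w = cliqueAbove? (suc s) K ×-dec (u ∈? K ∩ X ×-dec canReplace? K u w)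

  Switched : ℕ → Subset n → Fin n → Fin n → Set
  Switched s K u w = CliqueAbove s K × u ∈ X × w ∈ K

  switched? : ∀ s K u w → Dec (Switched s K u w)
  switched? s K u w = cliqueAbove? s K ×-dec (u ∈? X ×-dec w ∈? K)

  switch-switched : ∀ {s K u w} → Switch s K u w → Switched s (swap u w K) u w
  switch-switched {K = K} {u} {w} (((clique , ∣K∣≡r) , s<∣K∩X∣) , u∈K∩X , replace@(w∉K , _)) =
    ((swap-clique clique replace , trans (∣swap∣ {u = u} {w} {K}) ∣K∣≡r) , ≤-pred (≤-trans s<∣K∩X∣ (∣∩swap∣ X w∉K))) ,
    proj₂ (x∈p∩q⁻ K X u∈K∩X) , w∈swap (proj₁ (x∈p∩q⁻ K X u∈K∩X))

  ∑³ : (Subset n → Fin n → Fin n → ℕ) → ℕ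
  ∑³ f = ∑[ K ∈ allSubsets n ] ∑[ u ∈ allFin n ] ∑[ w ∈ allFin n ] f K u w

  switches≤switcheds : ∀ s → ∑³ (λ K u w → 𝟙 (switch? s K u w)) ≤ ∑³ (λ K u w → 𝟙 (switched? s K u w))
  switches≤switcheds s = begin
    ∑³ (λ K u w → 𝟙 (switch? s K u w))
      ≡⟨ ∑∑∑-comm (allSubsets n) (allFin n) (allFin n) _ ⟩
    ∑[ u ∈ allFin n ] ∑[ w ∈ allFin n ] ∑[ K ∈ allSubsets n ] 𝟙 (switch? s K u w)
      ≤⟨ ∑-mono-≤ (allFin n) (λ u → ∑-mono-≤ (allFin n) λ w → ∑-mono-≤ (allSubsets n) λ K →
           𝟙-mono (switch? s K u w) (switched? s (swap u w K) u w) switch-switched) ⟩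
    ∑[ u ∈ allFin n ] ∑[ w ∈ allFin n ] ∑[ K ∈ allSubsets n ] 𝟙 (switched? s (swap u w K) u w)
      ≡⟨ ∑-cong (allFin n) (λ u → ∑-cong (allFin n) λ w →
           ∑-reindex (allSubsets-unique n) (allSubsets-complete n) (swap u w) (swap w u)
             (swap-inverse u w) (swap-inverse w u) (λ K → 𝟙 (switched? s K u w))) ⟩
    ∑[ u ∈ allFin n ] ∑[ w ∈ allFin n ] ∑[ K ∈ allSubsets n ] 𝟙 (switched? s K u w)
      ≡⟨ ∑∑∑-comm (allSubsets n) (allFin n) (allFin n) _ ⟨
    ∑³ (λ K u w → 𝟙 (switched? s K u w))
      ∎
    where open ≤-Reasoning

  switcheds-at : ∀ s K → ∑[ u ∈ allFin n ] ∑[ w ∈ allFin n ] 𝟙 (switched? s K u w) ≡ 𝟙 (cliqueAbove? s K) * (∣ X ∣ * ∣ K ∣)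
  switcheds-at s K = begin
    ∑[ u ∈ allFin n ] ∑[ w ∈ allFin n ] 𝟙 (switched? s K u w)
      ≡⟨ ∑-cong (allFin n) (λ u → ∑-cong (allFin n) λ w →
           trans (𝟙-× A? (u ∈? X ×-dec w ∈? K)) (cong (𝟙 A? *_) (𝟙-× (u ∈? X) (w ∈? K)))) ⟩
    ∑[ u ∈ allFin n ] ∑[ w ∈ allFin n ] 𝟙 A? * (𝟙 (u ∈? X) * 𝟙 (w ∈? K))
      ≡⟨ ∑-cong (allFin n) (λ u → ∑-*ˡ (allFin n) (𝟙 A?) λ w → 𝟙 (u ∈? X) * 𝟙 (w ∈? K)) ⟩
    ∑[ u ∈ allFin n ] 𝟙 A? * (∑[ w ∈ allFin n ] 𝟙 (u ∈? X) * 𝟙 (w ∈? K))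
      ≡⟨ ∑-*ˡ (allFin n) (𝟙 A?) _ ⟩
    𝟙 A? * (∑[ u ∈ allFin n ] ∑[ w ∈ allFin n ] 𝟙 (u ∈? X) * 𝟙 (w ∈? K))
      ≡⟨ cong (𝟙 A? *_) (trans (∑∑-* (allFin n) (allFin n) _ _) (sym (cong₂ _*_ (∣p∣≡∑ X) (∣p∣≡∑ K)))) ⟩
    𝟙 A? * (∣ X ∣ * ∣ K ∣)
      ∎
    where
    open ≡-Reasoning
    A? : Dec (CliqueAbove s K)
    A? = cliqueAbove? s K

  module _ .{{_ : NonZero r}} (sparse : ∀ v → 2 * r * ∣ ∁ (N G v) ∣ ≤ n) where

    nonAdjacencies-bound : ∀ {K} → ∣ K ∣ ≡ r → 2 * nonAdjacencies K ≤ n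
    nonAdjacencies-bound {K} ∣K∣≡r = *-cancelˡ-≤ r (begin
      r * (2 * nonAdjacencies K)                              ≡⟨ *-assoc r 2 _ ⟨
      r * 2 * nonAdjacencies K                                ≡⟨ ∑-*ˡ (allFin n) (r * 2) _ ⟨
      ∑[ v ∈ allFin n ] r * 2 * (𝟙 (v ∈? K) * ∣ ∁ (N G v) ∣)  ≡⟨ ∑-cong (allFin n) (λ v → rearrange r (𝟙 (v ∈? K)) _) ⟩
      ∑[ v ∈ allFin n ] 𝟙 (v ∈? K) * (2 * r * ∣ ∁ (N G v) ∣)  ≤⟨ ∑-mono-≤ (allFin n) (λ v → *-monoʳ-≤ (𝟙 (v ∈? K)) (sparse v)) ⟩
      ∑[ v ∈ allFin n ] 𝟙 (v ∈? K) * n                        ≡⟨ ∑-*ʳ (allFin n) n _ ⟩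
      (∑[ v ∈ allFin n ] 𝟙 (v ∈? K)) * n                      ≡⟨ cong (_* n) (trans (sym (∣p∣≡∑ K)) ∣K∣≡r) ⟩
      r * n                                                   ∎)
      where
      open ≤-Reasoning
      rearrange : ∀ r a m → r * 2 * (a * m) ≡ a * (2 * r * m)
      rearrange = solve 3 (λ r a m → r :* con 2 :* (a :* m) := a :* (con 2 :* r :* m)) refl

    many-replacements : ∀ {K} → ∣ K ∣ ≡ r → ∀ u → n ≤ 2 * replacements K u
    many-replacements {K} ∣K∣≡r u = halving {a = replacements K u} (replacements-cover K u) (nonAdjacencies-bound ∣K∣≡r)

    switches-at : ∀ s K → 𝟙 (cliqueAbove? (suc s) K) * (suc s * n) ≤
                          2 * (∑[ u ∈ allFin n ] ∑[ w ∈ allFin n ] 𝟙 (switch? s K u w))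
    switches-at s K = begin
      𝟙 A? * (suc s * n)                                                  ≤⟨ 𝟙*-mono A? lower ⟩
      𝟙 A? * (2 * (∑[ u ∈ allFin n ] 𝟙 (u ∈? K ∩ X) * replacements K u)) ≡⟨ x*[y*z]≡y*[x*z] (𝟙 A?) 2 _ ⟩
      2 * (𝟙 A? * (∑[ u ∈ allFin n ] 𝟙 (u ∈? K ∩ X) * replacements K u)) ≡⟨ cong (2 *_) (sym factor) ⟩
      2 * (∑[ u ∈ allFin n ] ∑[ w ∈ allFin n ] 𝟙 (switch? s K u w))       ∎
      where
      open ≤-Reasoning
      A? : Dec (CliqueAbove (suc s) K)
      A? = cliqueAbove? (suc s) K
      x*[y*z]≡y*[x*z] : ∀ x y z → x * (y * z) ≡ y * (x * z)
      x*[y*z]≡y*[x*z] = solve 3 (λ x y z → x :* (y :* z) := y :* (x :* z)) refl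
      lower : CliqueAbove (suc s) K → suc s * n ≤ 2 * (∑[ u ∈ allFin n ] 𝟙 (u ∈? K ∩ X) * replacements K u)
      lower ((_ , ∣K∣≡r) , s<∣K∩X∣) = begin
        suc s * n
          ≤⟨ *-monoˡ-≤ n s<∣K∩X∣ ⟩
        ∣ K ∩ X ∣ * n
          ≡⟨ trans (cong (_* n) (∣p∣≡∑ (K ∩ X))) (sym (∑-*ʳ (allFin n) n _)) ⟩
        ∑[ u ∈ allFin n ] 𝟙 (u ∈? K ∩ X) * n
          ≤⟨ ∑-mono-≤ (allFin n) (λ u → *-monoʳ-≤ (𝟙 (u ∈? K ∩ X)) (many-replacements ∣K∣≡r u)) ⟩
        ∑[ u ∈ allFin n ] 𝟙 (u ∈? K ∩ X) * (2 * replacements K u)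
          ≡⟨ trans (∑-cong (allFin n) (λ u → x*[y*z]≡y*[x*z] (𝟙 (u ∈? K ∩ X)) 2 _)) (∑-*ˡ (allFin n) 2 _) ⟩
        2 * (∑[ u ∈ allFin n ] 𝟙 (u ∈? K ∩ X) * replacements K u)
          ∎
      factor : ∑[ u ∈ allFin n ] ∑[ w ∈ allFin n ] 𝟙 (switch? s K u w) ≡
               𝟙 A? * (∑[ u ∈ allFin n ] 𝟙 (u ∈? K ∩ X) * replacements K u)
      factor = trans (∑-cong (allFin n) λ u → trans
        (∑-cong (allFin n) λ w → trans (𝟙-× A? (u ∈? K ∩ X ×-dec canReplace? K u w))
                                       (cong (𝟙 A? *_) (𝟙-× (u ∈? K ∩ X) (canReplace? K u w))))
        (trans (∑-*ˡ (allFin n) (𝟙 A?) _) (cong (𝟙 A? *_) (∑-*ˡ (allFin n) (𝟙 (u ∈? K ∩ X)) _))))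
        (∑-*ˡ (allFin n) (𝟙 A?) _)

    cliquesAbove-step : ∀ s → cliquesAbove (suc s) * (suc s * n) ≤ 2 * (cliquesAbove s * (∣ X ∣ * r))
    cliquesAbove-step s = begin
      cliquesAbove (suc s) * (suc s * n)
        ≡⟨ trans (cong (_* (suc s * n)) (countSubsets≡∑ (cliqueAbove? (suc s)))) (sym (∑-*ʳ (allSubsets n) _ _)) ⟩
      ∑[ K ∈ allSubsets n ] 𝟙 (cliqueAbove? (suc s) K) * (suc s * n)
        ≤⟨ ∑-mono-≤ (allSubsets n) (switches-at s) ⟩
      ∑[ K ∈ allSubsets n ] 2 * (∑[ u ∈ allFin n ] ∑[ w ∈ allFin n ] 𝟙 (switch? s K u w))
        ≡⟨ ∑-*ˡ (allSubsets n) 2 _ ⟩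
      2 * ∑³ (λ K u w → 𝟙 (switch? s K u w))
        ≤⟨ *-monoʳ-≤ 2 (switches≤switcheds s) ⟩
      2 * ∑³ (λ K u w → 𝟙 (switched? s K u w))
        ≡⟨ cong (2 *_) (∑-cong (allSubsets n) (switcheds-at s)) ⟩
      2 * (∑[ K ∈ allSubsets n ] 𝟙 (cliqueAbove? s K) * (∣ X ∣ * ∣ K ∣))
        ≤⟨ *-monoʳ-≤ 2 (∑-mono-≤ (allSubsets n) λ K →
             𝟙*-mono (cliqueAbove? s K) λ ((_ , ∣K∣≡r) , _) → ≤-reflexive (cong (∣ X ∣ *_) ∣K∣≡r)) ⟩
      2 * (∑[ K ∈ allSubsets n ] 𝟙 (cliqueAbove? s K) * (∣ X ∣ * r))
        ≡⟨ cong (2 *_) (trans (∑-*ʳ (allSubsets n) _ _) (cong (_* (∣ X ∣ * r)) (sym (countSubsets≡∑ (cliqueAbove? s))))) ⟩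
      2 * (cliquesAbove s * (∣ X ∣ * r))
        ∎
      where open ≤-Reasoning

    cliquesAbove-decay : .{{_ : NonZero n}} → (600 * ∣ X ∣) ^ 2 * r ≤ n ^ 2 →
                         ∀ {s} → r ≤ (2 * suc s) ^ 2 → 150 * cliquesAbove (suc s) ≤ cliquesAbove s
    cliquesAbove-decay X-small {s} r≤[2+2s]² =
      decay-step 150 {suc s} {n} {∣ X ∣} {r} {cliquesAbove s} {cliquesAbove (suc s)} r≤[2+2s]² X-small (cliquesAbove-step s)

proposition4p3 : (r n : ℕ) → 3 ≤ r → (G : Graph n) →
    (∀ (v : Fin n) → (600 * (n ∸ deg G v)) ^ 2 * r ^ 3 ≤ n ^ 2) →
    (X : Subset n) → (600 * ∣ X ∣) ^ 2 * r ≤ n ^ 2 →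
    countSubsets (λ K → isRClique? G r K ×-dec (r ≤? ∣ K ∩ X ∣ ^ 2)) * r ^ 2 ≤ k G r
proposition4p3 r zero 3≤r G _ [] _ = begin
  countSubsets P? * r ^ 2  ≡⟨ cong (_* r ^ 2) (countSubsets≡∑ P?) ⟩
  (𝟙 (P? []) + 0) * r ^ 2  ≤⟨ *-monoˡ-≤ (r ^ 2) (+-monoˡ-≤ 0 (𝟙-mono (P? []) (no λ ()) λ (_ , r≤0) → <⇒≱ (≤-trans (s≤s z≤n) 3≤r) r≤0)) ⟩
  0                        ≤⟨ z≤n ⟩
  k G r                    ∎
  where
  open ≤-Reasoning
  P? : Decidable (λ K → IsRClique G r K × r ≤ ∣ K ∩ [] ∣ ^ 2)
  P? K = isRClique? G r K ×-dec (r ≤? ∣ K ∩ [] ∣ ^ 2)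
proposition4p3 r n@(suc _) 3≤r G few-nonAdjacent X X-small with least-square-above r
... | t , r≤t² , t-least = begin
  countSubsets P? * r ^ 2  ≤⟨ *-mono-≤ (squares≤cliquesAbove t-least) (r≤t²⇒r²≤150^⌈t/2⌉ {t = t} r≤t²) ⟩
  cliquesAbove t * 150 ^ j ≡⟨ *-comm _ (150 ^ j) ⟩
  150 ^ j * cliquesAbove t ≤⟨ subst (λ u → 150 ^ j * cliquesAbove u ≤ cliquesAbove h) j+h≡t (iterate-decay cliquesAbove decay j) ⟩
  cliquesAbove h           ≤⟨ cliquesAbove≤k h ⟩
  k G r                    ∎
  where
  open ≤-Reasoning
  1≤r : 1 ≤ r
  1≤r = ≤-trans (s≤s z≤n) 3≤r
  instance
    r≢0 : NonZero r
    r≢0 = >-nonZero 1≤r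
  open Cliques G X r
  P? : Decidable (λ K → IsRClique G r K × r ≤ ∣ K ∩ X ∣ ^ 2)
  P? K = isRClique? G r K ×-dec (r ≤? ∣ K ∩ X ∣ ^ 2)
  h j : ℕ
  h = ⌊ t /2⌋
  j = ⌈ t /2⌉
  j+h≡t : j + h ≡ t
  j+h≡t = trans (+-comm j h) (⌊n/2⌋+⌈n/2⌉≡n t)
  decay : ∀ {s} → h ≤ s → 150 * cliquesAbove (suc s) ≤ cliquesAbove s
  decay h≤s = cliquesAbove-decay (few-nonNeighbours G 1≤r few-nonAdjacent) X-small (r≤t²⇒r≤[2+2s]² {t = t} r≤t² h≤s)
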